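{- Let $S$ be a set of $n$ objects whose rank-distortion function is linear, i.e. $f(r)=cr$ for some constant $c>0$, with rank distortion $\gamma$. Then for all $x,y,z\in S$ the following four inequalities hold with $D=\gamma$; that is, the rank disorder of $S$ is at most $\gamma$: - $r_x(y,S)\le D(r_z(x,S)+r_z(y,S))$; - $r_x(y,S)\le D(r_x(z,S)+r_y(z,S))$; - $r_x(y,S)\le D(r_x(z,S)+r_z(y,S))$; - $r_x(y,S)\le D(r_z(x,S)+r_y(z,S))$.
   Context: Objects live in a hidden space with distance $d$ (not necessarily a metric), and all distances are distinct. Ranks: $r_v(u,S)=c$ if $u$ is the $c$-th nearest object to $v$ in $S$, with $r_x(x,S)=0$. For each object $o\in S$, let $\rho_o\in\{0,\dots,n-1\}^n$ be the vector whose coordinate indexed by $j\in S$ is $r_j(o,S)$. Rank distortion: $S$ has rank distortion function $f:\mathbb{N}_+\to\mathbb{N}_+$ if $f$ is monotonically increasing and there exists $\gamma>0$ (the rank distortion) such that for all $u,v\in S$, $$f(r_u(v,S))\le \|\rho_v-\rho_u\|_1\le \gamma f(r_u(v,S)).$$ The rank disorder of $S$ is the smallest $D$ for which the four inequalities in the claim hold for all $x,y,z\in S$.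
   Formalization: The hidden-space distances d and the rank distortion γ are rational. -}

module Defs where

open import Data.Nat as ℕ using (ℕ; zero; suc; ∣_-_∣)
open import Data.Fin using (Fin; zero; suc)
open import Data.Integer using (+_)
open import Data.Rational as ℚ using (ℚ; _/_; _≤_; _<_; 0ℚ; _+_; _*_)
open import Relation.Binary.PropositionalEquality using (_≡_; _≢_)
open import Relation.Nullary using (yes; no)
open import Data.Fin using (_≟_)

-- A finite set S of n objects is modelled as Fin n; the hidden space is
-- given by a (not necessarily metric, not necessarily symmetric)
-- distance function d : Fin n → Fin n → ℚ.
Dist : ℕ → Set
Dist n = Fin n → Fin n → ℚ

sumFin : ∀ {n} → (Fin n → ℕ) → ℕ
sumFin {zero}  g = 0
sumFin {suc n} g = g zero ℕ.+ sumFin (λ j → g (suc j))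


-- "All distances are distinct": the distances from any object v to the
-- other objects are pairwise distinct (this is what makes ranks well defined).
DistinctDistances : ∀ {n} → Dist n → Set
DistinctDistances {n} d =
  ∀ (v u w : Fin n) → u ≢ v → w ≢ v → u ≢ w → d v u ≢ d v w

closerInd : ∀ {n} → Dist n → Fin n → Fin n → Fin n → ℕ
closerInd d v u w with w ≟ v
... | yes _ = 0
... | no  _ with ℚ._<?_ (d v w) (d v u)
...   | yes _ = 1
...   | no  _ = 0

-- rank r_v(u,S): u is the c-th nearest object to v in S (among S ∖ {v}),
-- with the convention r_v(v,S) = 0.
rank : ∀ {n} → Dist n → Fin n → Fin n → ℕ
rank d v u with u ≟ v
... | yes _ = 0
... | no  _ = suc (sumFin (closerInd d v u))

rankL1 : ∀ {n} → Dist n → Fin n → Fin n → ℕ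
rankL1 d v u = sumFin (λ j → ∣ rank d j v - rank d j u ∣)

ℕ→ℚ : ℕ → ℚ
ℕ→ℚ m = + m / 1

MonoIncreasing : (ℕ → ℚ) → Set
MonoIncreasing f = ∀ (a b : ℕ) → 1 ℕ.≤ a → a ℕ.< b → f a < f b

-- S has rank distortion function f with rank distortion γ > 0:
-- for all u ≠ v (so that r_u(v,S) ∈ ℕ₊, the domain of f),
--   f(r_u(v,S)) ≤ ‖ρ_v − ρ_u‖₁ ≤ γ f(r_u(v,S)).
RankDistortion : ∀ {n} → Dist n → (ℕ → ℚ) → ℚ → Set
RankDistortion {n} d f γ =
  MonoIncreasing f × (0ℚ < γ) ×
  (∀ (u v : Fin n) → u ≢ v →
     (f (rank d u v) ≤ ℕ→ℚ (rankL1 d v u)) ×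
     (ℕ→ℚ (rankL1 d v u) ≤ γ * f (rank d u v)))
  where open import Data.Product using (_×_)

RankDisorderBound : ∀ {n} → Dist n → ℚ → Set
RankDisorderBound {n} d D =
  ∀ (x y z : Fin n) →
    (ℕ→ℚ (rank d x y) ≤ D * (ℕ→ℚ (rank d z x) + ℕ→ℚ (rank d z y))) ×
    (ℕ→ℚ (rank d x y) ≤ D * (ℕ→ℚ (rank d x z) + ℕ→ℚ (rank d y z))) ×
    (ℕ→ℚ (rank d x y) ≤ D * (ℕ→ℚ (rank d x z) + ℕ→ℚ (rank d z y))) ×
    (ℕ→ℚ (rank d x y) ≤ D * (ℕ→ℚ (rank d z x) + ℕ→ℚ (rank d y z)))
  where open import Data.Product using (_×_)

-- Stacking the rank vectors ρ makes ‖ρ_u − ρ_v‖₁ a pseudometric on S. With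
-- f(r) = c r the distortion bounds read c r_u(v) ≤ ‖ρ_v − ρ_u‖₁ ≤ γ c r_u(v), so
--   c r_x(y) ≤ ‖ρ_x − ρ_y‖₁ ≤ ‖ρ_x − ρ_z‖₁ + ‖ρ_z − ρ_y‖₁ ≤ γ c (a + b),
-- where, by symmetry of the norm, a can be either of r_x(z), r_z(x) and b either
-- of r_z(y), r_y(z); cancelling c gives the four inequalities.
module Submission where

open import Defs
open import Data.Nat using (ℕ)
open import Data.Rational using (ℚ; _<_; 0ℚ; _*_)

import Data.Nat as ℕ
import Data.Nat.Properties as ℕ
import Data.Integer as ℤ
import Data.Integer.Properties as ℤ
import Data.Rational as ℚ
import Data.Rational.Properties as ℚ
import Data.Rational.Unnormalised as ℚᵘ
import Data.Rational.Unnormalised.Properties as ℚᵘ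
import Data.Nat.Coprimality as Coprimality
import Algebra.Properties.CommutativeSemigroup as CommutativeSemigroupProperties
open import Data.Fin using (Fin; zero; suc; _≟_)
open import Data.Product using (_,_; proj₁; proj₂)
open import Data.Empty using (⊥-elim)
open import Relation.Nullary using (yes; no)
open import Relation.Binary.PropositionalEquality

sumFin-cong : ∀ {n} {g h : Fin n → ℕ} → (∀ j → g j ≡ h j) → sumFin g ≡ sumFin h
sumFin-cong {ℕ.zero}  g≡h = refl
sumFin-cong {ℕ.suc n} g≡h = cong₂ ℕ._+_ (g≡h zero) (sumFin-cong (λ j → g≡h (suc j)))

sumFin-zero : ∀ n → sumFin {n} (λ _ → 0) ≡ 0
sumFin-zero ℕ.zero    = refl
sumFin-zero (ℕ.suc n) = sumFin-zero n

sumFin-mono : ∀ {n} {g h : Fin n → ℕ} → (∀ j → g j ℕ.≤ h j) → sumFin g ℕ.≤ sumFin h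
sumFin-mono {ℕ.zero}  g≤h = ℕ.z≤n
sumFin-mono {ℕ.suc n} g≤h = ℕ.+-mono-≤ (g≤h zero) (sumFin-mono (λ j → g≤h (suc j)))

sumFin-+ : ∀ {n} (g h : Fin n → ℕ) → sumFin (λ j → g j ℕ.+ h j) ≡ sumFin g ℕ.+ sumFin h
sumFin-+ {ℕ.zero}  g h = refl
sumFin-+ {ℕ.suc n} g h = trans
  (cong ((g zero ℕ.+ h zero) ℕ.+_) (sumFin-+ (λ j → g (suc j)) (λ j → h (suc j))))
  (+-interchange (g zero) (h zero) (sumFin (λ j → g (suc j))) (sumFin (λ j → h (suc j))))
  where open CommutativeSemigroupProperties ℕ.+-commutativeSemigroup
          renaming (interchange to +-interchange)

module _ {n : ℕ} (d : Dist n) where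

  rank-self : ∀ x → rank d x x ≡ 0
  rank-self x with x ≟ x
  ... | yes _   = refl
  ... | no x≢x = ⊥-elim (x≢x refl)

  rankL1-self : ∀ x → rankL1 d x x ≡ 0
  rankL1-self x = trans (sumFin-cong (λ j → ℕ.∣n-n∣≡0 (rank d j x))) (sumFin-zero n)

  rankL1-comm : ∀ x y → rankL1 d x y ≡ rankL1 d y x
  rankL1-comm x y = sumFin-cong (λ j → ℕ.∣-∣-comm (rank d j x) (rank d j y))

  rankL1-triangle : ∀ x y z → rankL1 d x y ℕ.≤ rankL1 d x z ℕ.+ rankL1 d z y
  rankL1-triangle x y z = begin
    rankL1 d x y
      ≤⟨ sumFin-mono (λ j → ℕ.∣-∣-triangle (rank d j x) (rank d j z) (rank d j y)) ⟩
    sumFin (λ j → rank-gap x z j ℕ.+ rank-gap z y j)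
      ≡⟨ sumFin-+ (rank-gap x z) (rank-gap z y) ⟩
    rankL1 d x z ℕ.+ rankL1 d z y ∎
    where
    open ℕ.≤-Reasoning
    rank-gap : Fin n → Fin n → Fin n → ℕ
    rank-gap u v j = ℕ.∣ rank d j u - rank d j v ∣

ℕ→ℚ-mkℚ : ∀ m → ℕ→ℚ m ≡ ℚ.mkℚ (ℤ.+ m) 0 (Coprimality.sym (Coprimality.1-coprimeTo m))
ℕ→ℚ-mkℚ m = ℚ.normalize-coprime (Coprimality.sym (Coprimality.1-coprimeTo m))

ℕ→ℚ-mono-≤ : ∀ {a b} → a ℕ.≤ b → ℕ→ℚ a ℚ.≤ ℕ→ℚ b
ℕ→ℚ-mono-≤ {a} {b} a≤b rewrite ℕ→ℚ-mkℚ a | ℕ→ℚ-mkℚ b =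
  ℚ.*≤* (ℤ.*-monoʳ-≤-nonNeg (ℤ.+ 1) (ℤ.+≤+ a≤b))

ℕ→ℚ-nonNeg : ∀ m → 0ℚ ℚ.≤ ℕ→ℚ m
ℕ→ℚ-nonNeg m = ℕ→ℚ-mono-≤ {0} {m} ℕ.z≤n

ℕ→ℚ-homo-+ : ∀ a b → ℕ→ℚ (a ℕ.+ b) ≡ ℕ→ℚ a ℚ.+ ℕ→ℚ b
ℕ→ℚ-homo-+ a b =
  ℚ.toℚᵘ-injective (ℚᵘ.≃-trans toℚᵘ-homo (ℚᵘ.≃-sym (ℚ.toℚᵘ-homo-+ (ℕ→ℚ a) (ℕ→ℚ b))))
  where
  toℚᵘ-homo : ℚ.toℚᵘ (ℕ→ℚ (a ℕ.+ b)) ℚᵘ.≃ ℚ.toℚᵘ (ℕ→ℚ a) ℚᵘ.+ ℚ.toℚᵘ (ℕ→ℚ b)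
  toℚᵘ-homo rewrite ℕ→ℚ-mkℚ (a ℕ.+ b) | ℕ→ℚ-mkℚ a | ℕ→ℚ-mkℚ b =
    ℚᵘ.*≡* (cong (ℤ._* ℤ.+ 1) (trans (ℤ.pos-+ a b)
      (sym (cong₂ ℤ._+_ (ℤ.*-identityʳ (ℤ.+ a)) (ℤ.*-identityʳ (ℤ.+ b))))))

*-cancel-scaled-triangle : ∀ (c γ r p q a b : ℚ) .{{_ : ℚ.Positive c}} →
  c * r ℚ.≤ p ℚ.+ q → p ℚ.≤ γ * (c * a) → q ℚ.≤ γ * (c * b) → r ℚ.≤ γ * (a ℚ.+ b)
*-cancel-scaled-triangle c γ r p q a b cr≤p+q p≤ q≤ = ℚ.*-cancelˡ-≤-pos c (begin
  c * r                       ≤⟨ cr≤p+q ⟩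
  p ℚ.+ q                     ≤⟨ ℚ.+-mono-≤ p≤ q≤ ⟩
  γ * (c * a) ℚ.+ γ * (c * b) ≡⟨ cong₂ ℚ._+_ (swap-scalars γ c a) (swap-scalars γ c b) ⟩
  c * (γ * a) ℚ.+ c * (γ * b) ≡⟨ ℚ.*-distribˡ-+ c (γ * a) (γ * b) ⟨
  c * (γ * a ℚ.+ γ * b)       ≡⟨ cong (c *_) (ℚ.*-distribˡ-+ γ a b) ⟨
  c * (γ * (a ℚ.+ b))         ∎)
  where
  open ℚ.≤-Reasoning
  swap-scalars : ∀ s t x → s * (t * x) ≡ t * (s * x)
  swap-scalars s t x =
    trans (sym (ℚ.*-assoc s t x)) (trans (cong (_* x) (ℚ.*-comm s t)) (ℚ.*-assoc t s x))

module LinearRankDistortion {n : ℕ} (d : Dist n) (c γ : ℚ) (0<c : 0ℚ < c)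
         (distortion : RankDistortion d (λ r → c * ℕ→ℚ r) γ) where

  private
    L : Fin n → Fin n → ℚ
    L u v = ℕ→ℚ (rankL1 d u v)

    cr : Fin n → Fin n → ℚ
    cr u v = c * ℕ→ℚ (rank d u v)

  rankL1-≤-upper : ∀ u v → L v u ℚ.≤ γ * cr u v
  rankL1-≤-upper u v with u ≟ v
  ... | no u≢v   = proj₂ (proj₂ (proj₂ distortion) u v u≢v)
  ... | yes refl rewrite rank-self d u | rankL1-self d u | ℚ.*-zeroʳ c | ℚ.*-zeroʳ γ =
    ℚ.≤-refl

  rankL1-≤-upper′ : ∀ u v → L u v ℚ.≤ γ * cr u v
  rankL1-≤-upper′ u v rewrite rankL1-comm d u v = rankL1-≤-upper u v

  rankL1-≥-lower : ∀ u v → cr u v ℚ.≤ L u v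
  rankL1-≥-lower u v with u ≟ v
  ... | no u≢v   rewrite rankL1-comm d u v = proj₁ (proj₂ (proj₂ distortion) u v u≢v)
  ... | yes refl rewrite rank-self d u | ℚ.*-zeroʳ c = ℕ→ℚ-nonNeg (rankL1 d u u)

  rank-≤-via-triangle : ∀ x y z a b → L x z ℚ.≤ γ * (c * ℕ→ℚ a) → L z y ℚ.≤ γ * (c * ℕ→ℚ b) →
    ℕ→ℚ (rank d x y) ℚ.≤ γ * (ℕ→ℚ a ℚ.+ ℕ→ℚ b)
  rank-≤-via-triangle x y z a b =
    *-cancel-scaled-triangle c γ (ℕ→ℚ (rank d x y)) (L x z) (L z y) (ℕ→ℚ a) (ℕ→ℚ b)
      (ℚ.≤-trans (rankL1-≥-lower x y) (ℚ.≤-trans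
        (ℕ→ℚ-mono-≤ (rankL1-triangle d x y z))
        (ℚ.≤-reflexive (ℕ→ℚ-homo-+ (rankL1 d x z) (rankL1 d z y)))))
    where instance _ = ℚ.positive 0<c

lemma1 : ∀ (n : ℕ) (d : Dist n) → DistinctDistances d →
    ∀ (c γ : ℚ) → 0ℚ < c →
    RankDistortion d (λ r → c * ℕ→ℚ r) γ →
    RankDisorderBound d γ
lemma1 n d _ c γ 0<c distortion x y z =
    rank-≤-via-triangle x y z (rank d z x) (rank d z y) (rankL1-≤-upper z x) (rankL1-≤-upper′ z y)
  , rank-≤-via-triangle x y z (rank d x z) (rank d y z) (rankL1-≤-upper′ x z) (rankL1-≤-upper y z)
  , rank-≤-via-triangle x y z (rank d x z) (rank d z y) (rankL1-≤-upper′ x z) (rankL1-≤-upper′ z y)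
  , rank-≤-via-triangle x y z (rank d z x) (rank d y z) (rankL1-≤-upper z x) (rankL1-≤-upper y z)
  where open LinearRankDistortion d c γ 0<c distortion
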